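{- Let $q\ge5$ be prime, $q^*=(-1)^{(q-1)/2}q$ and $u_q(j)=(3^j-q^*(-1)^j)/4$, and let $n\ge1$. (a) If $3$ is a primitive root modulo $q$, then $u_q(1),\ldots,u_q(n)$ are pairwise incongruent modulo $q$ if and only if $q\ge n+1$. (b) If $3$ is a primitive root modulo $q$ and $3^{q-1}\not\equiv1\pmod{q^2}$, then for every integer $f\ge1$, $u_q(1),\ldots,u_q(n)$ are pairwise incongruent modulo $q^f$ if and only if $q^f\ge qn/(q-1)$. -}

module Defs where

open import Data.Nat as ℕ using (ℕ; _∸_; _≤_; _<_)
open import Data.Nat.Divisibility as ℕD using ()
open import Data.Nat.Coprimality using (Coprime)
open import Data.Integer as ℤ using (ℤ; +_; -[1+_])
open import Data.Integer.Divisibility using (_∣_)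
open import Relation.Nullary using (¬_)
open import Data.Product using (_×_)

qStar : ℕ → ℤ
qStar q = (ℤ.- (+ 1)) ℤ.^ ((q ∸ 1) ℕ./ 2) ℤ.* (+ q)

-- u_q(j) = (3^j - q* (-1)^j) / 4   (an exact division: numerator ≡ 0 mod 4 for odd prime q)
u : ℕ → ℕ → ℤ
u q j = ((+ 3) ℤ.^ j ℤ.- qStar q ℤ.* ((ℤ.- (+ 1)) ℤ.^ j)) ℤ./ (+ 4)

IsPrimitiveRootModPrime : ℕ → ℕ → Set
IsPrimitiveRootModPrime g q =
  Coprime g q ×
  (∀ k → 1 ≤ k → k < q ∸ 1 → ¬ ((+ q) ∣ ((+ g) ℤ.^ k ℤ.- + 1)))

PairwiseIncongruent : ℕ → ℕ → ℕ → Set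
PairwiseIncongruent q n m =
  ∀ i j → 1 ≤ i → i ≤ n → 1 ≤ j → j ≤ n → i < j →
    ¬ ((+ m) ∣ (u q i ℤ.- u q j))

{-# OPTIONS --safe #-}
-- Four times u(j) is 3^j - q*(-1)^j, so
--   4 (u(i + D) - u(i)) = 3^i (3^D - 1) - q* (-1)^i ((-1)^D - 1).
-- For even D the q*-term vanishes, and since 3 and 4 are units modulo q^f, the terms u(i) and
-- u(i + D) are congruent modulo q^f exactly when the order N of 3 modulo q^f divides D.  For odd D,
-- reducing modulo q (which divides q*) would give q - 1 ∣ D, impossible as q - 1 is even.  Hence the first
-- n terms are pairwise incongruent iff n ≤ N.  Since 3 is a primitive root, N = q - 1 for f = 1,
-- and as 3^(q-1) ≢ 1 (mod q²), lifting the exponent gives N = (q - 1) q^(f-1) in general.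
module Submission where

open import Defs

module MultiplicativeOrder where

  open import Data.Empty using (⊥-elim)
  open import Data.Fin.Base as Fin using (Fin; toℕ; fromℕ<)
  import Data.Fin.Properties as Fin
  open import Data.Integer.Base using (ℤ; +_; 1ℤ; _+_; _-_; _*_; _^_; ∣_∣)
  import Data.Integer.Coprimality as ℤ using (coprime-divisor)
  open import Data.Integer.Divisibility.Signed
  import Data.Integer.Properties as ℤ
  open import Data.Integer.Tactic.RingSolver using (solve-∀)
  open import Data.Nat.Base as ℕ using (ℕ; zero; suc; _∸_; z<s)
  import Data.Nat.Coprimality as ℕ
  import Data.Nat.Divisibility as ℕ
  import Data.Nat.DivMod as ℕ
  open import Data.Nat.Primality using (Prime; prime⇒irreducible; prime⇒nonZero; prime⇒nonTrivial)
  import Data.Nat.Properties as ℕ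
  open import Data.Product using (∃; _×_; _,_; proj₁)
  open import Data.Sum using (inj₁; inj₂)
  open import Function.Base using (_∘_)
  open import Function.Bundles using (_⇔_; mk⇔; Equivalence)
  open import Relation.Binary.PropositionalEquality
  open import Relation.Nullary using (¬_)

  open ≡-Reasoning

  pos-^ : ∀ m n → + (m ℕ.^ n) ≡ (+ m) ^ n
  pos-^ m zero    = refl
  pos-^ m (suc n) = trans (ℤ.pos-* m (m ℕ.^ n)) (cong (+ m *_) (pos-^ m n))

  abs-^ : ∀ i n → ∣ i ^ n ∣ ≡ ∣ i ∣ ℕ.^ n
  abs-^ i zero    = refl
  abs-^ i (suc n) = trans (ℤ.abs-* i (i ^ n)) (cong (∣ i ∣ ℕ.*_) (abs-^ i n))

  p∣p^suc : ∀ p e → + p ∣ + (p ℕ.^ suc e)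
  p∣p^suc p e = divides (+ (p ℕ.^ e)) (trans (ℤ.pos-* p _) (ℤ.*-comm (+ p) _))

  coprime-*ʳ : ∀ {m a b} → ℕ.Coprime m a → ℕ.Coprime m b → ℕ.Coprime m (a ℕ.* b)
  coprime-*ʳ {a = a} m⊥a m⊥b (d∣m , d∣ab) = m⊥b (d∣m , ℕ.coprime-divisor d⊥a d∣ab)
    where
    d⊥a : ℕ.Coprime _ a
    d⊥a (k∣d , k∣a) = m⊥a (ℕ.∣-trans k∣d d∣m , k∣a)

  coprime-^ʳ : ∀ {m a} → ℕ.Coprime m a → ∀ k → ℕ.Coprime m (a ℕ.^ k)
  coprime-^ʳ m⊥a zero    (_ , d∣1) = ℕ.∣1⇒≡1 d∣1
  coprime-^ʳ m⊥a (suc k) = coprime-*ʳ m⊥a (coprime-^ʳ m⊥a k)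

  coprime-^ˡ : ∀ {m a} → ℕ.Coprime m a → ∀ k → ℕ.Coprime (m ℕ.^ k) a
  coprime-^ˡ m⊥a k = ℕ.sym (coprime-^ʳ (ℕ.sym m⊥a) k)

  coprime-∣ˡ : ∀ {k m n} → k ℕ.∣ m → ℕ.Coprime m n → ℕ.Coprime k n
  coprime-∣ˡ k∣m m⊥n (d∣k , d∣n) = m⊥n (ℕ.∣-trans d∣k k∣m , d∣n)

  prime∤⇒coprime : ∀ {p n} → Prime p → ¬ p ℕ.∣ n → ℕ.Coprime p n
  prime∤⇒coprime p-prime p∤n (d∣p , d∣n) with prime⇒irreducible p-prime d∣p
  ... | inj₁ d≡1 = d≡1
  ... | inj₂ refl = ⊥-elim (p∤n d∣n)

  coprime-∣*⇔ : ∀ {m} c {x} → ℕ.Coprime m ∣ c ∣ → (+ m ∣ c * x) ⇔ (+ m ∣ x)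
  coprime-∣*⇔ {m} c {x} m⊥c = mk⇔
    (λ m∣cx → ∣ᵤ⇒∣ (ℤ.coprime-divisor (+ m) c x m⊥c (∣⇒∣ᵤ m∣cx)))
    (∣n⇒∣m*n c)

  coprime-∣^*⇔ : ∀ {n a} → ℕ.Coprime n a → ∀ i {x} → (+ n ∣ (+ a) ^ i * x) ⇔ (+ n ∣ x)
  coprime-∣^*⇔ {n} {a} n⊥a i =
    coprime-∣*⇔ ((+ a) ^ i) (subst (ℕ.Coprime n) (sym (abs-^ (+ a) i)) (coprime-^ʳ n⊥a i))

  -- Second-order binomial expansion

  binomialTail : ℤ → ℕ → ℤ
  binomialTail x zero    = + 0
  binomialTail x (suc k) = x * binomialTail x k + + k

  binomial-expansion : ∀ x k →
    x ^ k ≡ 1ℤ + + k * (x - 1ℤ) + (x - 1ℤ) * (x - 1ℤ) * binomialTail x k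
  binomial-expansion x zero    = base x
    where
    base : ∀ x → 1ℤ ≡ 1ℤ + + 0 * (x - 1ℤ) + (x - 1ℤ) * (x - 1ℤ) * + 0
    base = solve-∀
  binomial-expansion x (suc k) = begin
    x * x ^ k
      ≡⟨ cong (x *_) (binomial-expansion x k) ⟩
    x * (1ℤ + + k * (x - 1ℤ) + (x - 1ℤ) * (x - 1ℤ) * binomialTail x k)
      ≡⟨ step x (+ k) (binomialTail x k) ⟩
    1ℤ + + suc k * (x - 1ℤ) + (x - 1ℤ) * (x - 1ℤ) * binomialTail x (suc k) ∎
    where
    step : ∀ x k c → x * (1ℤ + k * (x - 1ℤ) + (x - 1ℤ) * (x - 1ℤ) * c)
                   ≡ 1ℤ + (1ℤ + k) * (x - 1ℤ) + (x - 1ℤ) * (x - 1ℤ) * (x * c + k)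
    step = solve-∀

  binomialTail-twice : ∀ x k → ∃ λ e → + 2 * binomialTail x k ≡ + k * (+ k - 1ℤ) + (x - 1ℤ) * e
  binomialTail-twice x zero = + 0 , base x
    where
    base : ∀ x → + 2 * + 0 ≡ + 0 * (+ 0 - 1ℤ) + (x - 1ℤ) * + 0
    base = solve-∀
  binomialTail-twice x (suc k) with binomialTail-twice x k
  ... | e , twice = e + + 2 * c , (begin
    + 2 * (x * c + + k)                          ≡⟨ split x c (+ k) ⟩
    + 2 * c + (x - 1ℤ) * (+ 2 * c) + + 2 * + k   ≡⟨ cong (λ z → z + (x - 1ℤ) * (+ 2 * c) + + 2 * + k) twice ⟩
    + k * (+ k - 1ℤ) + (x - 1ℤ) * e + (x - 1ℤ) * (+ 2 * c) + + 2 * + k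
                                                 ≡⟨ collect x (+ k) c e ⟩
    + suc k * (+ suc k - 1ℤ) + (x - 1ℤ) * (e + + 2 * c) ∎)
    where
    c = binomialTail x k
    split : ∀ x c k → + 2 * (x * c + k) ≡ + 2 * c + (x - 1ℤ) * (+ 2 * c) + + 2 * k
    split = solve-∀
    collect : ∀ x k c e → k * (k - 1ℤ) + (x - 1ℤ) * e + (x - 1ℤ) * (+ 2 * c) + + 2 * k
                        ≡ (1ℤ + k) * ((1ℤ + k) - 1ℤ) + (x - 1ℤ) * (e + + 2 * c)
    collect = solve-∀

  -- binomialTail x k ≡ k (k - 1) / 2 modulo x - 1; the division by 2 is why p must be odd.
  prime∣binomialTail : ∀ {p x} → Prime p → 2 ℕ.< p → + p ∣ x - 1ℤ → + p ∣ binomialTail x p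
  prime∣binomialTail {p} {x} p-prime 2<p p∣x-1 with binomialTail-twice x p
  ... | e , twice = Equivalence.to (coprime-∣*⇔ (+ 2) (ℕ.prime⇒coprime p-prime 2<p)) p∣2c
    where
    p∣2c : + p ∣ + 2 * binomialTail x p
    p∣2c = subst (+ p ∣_) (sym twice) (∣m∣n⇒∣m+n (∣m⇒∣m*n _ ∣-refl) (∣m⇒∣m*n e p∣x-1))

  sub-one-∣-pow-sub-one : ∀ x k → x - 1ℤ ∣ x ^ k - 1ℤ
  sub-one-∣-pow-sub-one x k = divides (+ k + (x - 1ℤ) * binomialTail x k) (begin
    x ^ k - 1ℤ
      ≡⟨ cong (_- 1ℤ) (binomial-expansion x k) ⟩
    1ℤ + + k * (x - 1ℤ) + (x - 1ℤ) * (x - 1ℤ) * binomialTail x k - 1ℤ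
      ≡⟨ factor x (+ k) (binomialTail x k) ⟩
    (+ k + (x - 1ℤ) * binomialTail x k) * (x - 1ℤ) ∎)
    where
    factor : ∀ x k c → 1ℤ + k * (x - 1ℤ) + (x - 1ℤ) * (x - 1ℤ) * c - 1ℤ ≡ (k + (x - 1ℤ) * c) * (x - 1ℤ)
    factor = solve-∀

  -- Multiplicative order

  IsOrderMod : ℕ → ℤ → ℕ → Set
  IsOrderMod m a N = ∀ d → (+ m ∣ a ^ d - 1ℤ) ⇔ N ℕ.∣ d

  ∣pow-sub-one⇒∣pow-multiple-sub-one : ∀ {m a N d} → + m ∣ a ^ N - 1ℤ → N ℕ.∣ d → + m ∣ a ^ d - 1ℤ
  ∣pow-sub-one⇒∣pow-multiple-sub-one {m} {a} {N} m∣aᴺ-1 (ℕ.divides k refl) =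
    subst (λ y → + m ∣ y - 1ℤ) (trans (ℤ.^-*-assoc a N k) (cong (a ^_) (ℕ.*-comm N k)))
      (∣-trans m∣aᴺ-1 (sub-one-∣-pow-sub-one (a ^ N) k))

  minimal⇒isOrderMod : ∀ {m a N} .{{_ : ℕ.NonZero N}} → + m ∣ a ^ N - 1ℤ →
    (∀ r → 0 ℕ.< r → r ℕ.< N → ¬ (+ m ∣ a ^ r - 1ℤ)) → IsOrderMod m a N
  minimal⇒isOrderMod {m} {a} {N} m∣aᴺ-1 minimal d = mk⇔ to (∣pow-sub-one⇒∣pow-multiple-sub-one m∣aᴺ-1)
    where
    r = d ℕ.% N
    k = d ℕ./ N
    split : ∀ A B → A * B - 1ℤ ≡ A * (B - 1ℤ) + (A - 1ℤ)
    split = solve-∀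
    aᵈ-1≡ : a ^ d - 1ℤ ≡ a ^ r * (a ^ (k ℕ.* N) - 1ℤ) + (a ^ r - 1ℤ)
    aᵈ-1≡ = begin
      a ^ d - 1ℤ                ≡⟨ cong (λ n → a ^ n - 1ℤ) (ℕ.m≡m%n+[m/n]*n d N) ⟩
      a ^ (r ℕ.+ k ℕ.* N) - 1ℤ  ≡⟨ cong (_- 1ℤ) (ℤ.^-distribˡ-+-* a r (k ℕ.* N)) ⟩
      a ^ r * a ^ (k ℕ.* N) - 1ℤ ≡⟨ split (a ^ r) (a ^ (k ℕ.* N)) ⟩
      a ^ r * (a ^ (k ℕ.* N) - 1ℤ) + (a ^ r - 1ℤ) ∎
    to : + m ∣ a ^ d - 1ℤ → N ℕ.∣ d
    to m∣aᵈ-1 with r in r≡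
    ... | zero  = ℕ.m%n≡0⇒n∣m d N r≡
    ... | suc _ = ⊥-elim (minimal r (subst (0 ℕ.<_) (sym r≡) z<s) (ℕ.m%n<n d N) m∣aʳ-1)
      where
      m∣aʳ-1 : + m ∣ a ^ r - 1ℤ
      m∣aʳ-1 = ∣m+n∣m⇒∣n (subst (+ m ∣_) aᵈ-1≡ m∣aᵈ-1)
        (∣n⇒∣m*n (a ^ r) (∣pow-sub-one⇒∣pow-multiple-sub-one m∣aᴺ-1 (ℕ.n∣m*n k)))

  %-≡⇒∣- : ∀ {m n p} .{{_ : ℕ.NonZero p}} → m ℕ.% p ≡ n ℕ.% p → + p ∣ + n - + m
  %-≡⇒∣- {m} {n} {p} m%p≡n%p = divides (+ (n ℕ./ p) - + (m ℕ./ p)) (begin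
    + n - + m                              ≡⟨ cong₂ _-_ (expand n) (expand m) ⟩
    + r′ + + (n ℕ./ p) * + p - (+ r + + (m ℕ./ p) * + p)
                                           ≡⟨ cong (λ s → + r′ + + (n ℕ./ p) * + p - (+ s + + (m ℕ./ p) * + p)) m%p≡n%p ⟩
    + r′ + + (n ℕ./ p) * + p - (+ r′ + + (m ℕ./ p) * + p)
                                           ≡⟨ cancel (+ r′) (+ (n ℕ./ p)) (+ (m ℕ./ p)) (+ p) ⟩
    (+ (n ℕ./ p) - + (m ℕ./ p)) * + p ∎)
    where
    r = m ℕ.% p
    r′ = n ℕ.% p
    expand : ∀ k → + k ≡ + (k ℕ.% p) + + (k ℕ./ p) * + p
    expand k = trans (cong +_ (ℕ.m≡m%n+[m/n]*n k p))
                     (trans (ℤ.pos-+ (k ℕ.% p) _) (cong (_+_ (+ (k ℕ.% p))) (ℤ.pos-* (k ℕ./ p) p)))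
    cancel : ∀ r B A p → r + B * p - (r + A * p) ≡ (B - A) * p
    cancel = solve-∀

  -- Pigeonhole: the p residues of a^0, …, a^(p-1) modulo p lie in the p - 1 nonzero classes.
  pow≡1-mod-prime : ∀ {p a} → Prime p → ℕ.Coprime p a →
    ∃ λ d → 0 ℕ.< d × d ℕ.< p × + p ∣ (+ a) ^ d - 1ℤ
  pow≡1-mod-prime {p} {a} p-prime p⊥a =
    from-collision (Fin.pigeonhole (ℕ.∸-monoʳ-< z<s (ℕ.n≢0⇒n>0 (ℕ.≢-nonZero⁻¹ p))) slot)
    where
    instance _ = prime⇒nonZero p-prime
    residue : ℕ → ℕ
    residue k = a ℕ.^ k ℕ.% p
    0<residue : ∀ k → 0 ℕ.< residue k
    0<residue k = ℕ.n≢0⇒n>0 λ residue≡0 →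
      ℕ.nonTrivial⇒≢1 {{prime⇒nonTrivial p-prime}}
        (coprime-^ʳ p⊥a k (ℕ.∣-refl , ℕ.m%n≡0⇒n∣m _ p residue≡0))
    slot : Fin p → Fin (p ∸ 1)
    slot k = fromℕ< (ℕ.∸-monoˡ-< (ℕ.m%n<n (a ℕ.^ toℕ k) p) (0<residue (toℕ k)))
    same-residue : ∀ i j → slot i ≡ slot j → residue (toℕ i) ≡ residue (toℕ j)
    same-residue i j same = ℕ.∸-cancelʳ-≡ (0<residue (toℕ i)) (0<residue (toℕ j))
      (trans (sym (Fin.toℕ-fromℕ< _)) (trans (cong toℕ same) (Fin.toℕ-fromℕ< _)))
    from-collision : (∃ λ i → ∃ λ j → i Fin.< j × slot i ≡ slot j) →
      ∃ λ d → 0 ℕ.< d × d ℕ.< p × + p ∣ (+ a) ^ d - 1ℤ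
    from-collision (i , j , i<j , same) = d , ℕ.m<n⇒0<n∸m i<j ,
      ℕ.≤-<-trans (ℕ.m∸n≤m (toℕ j) (toℕ i)) (Fin.toℕ<n j) , p∣aᵈ-1
      where
      d = toℕ j ∸ toℕ i
      factor : ∀ A B → A * B - A ≡ A * (B - 1ℤ)
      factor = solve-∀
      aʲ-aⁱ≡ : + (a ℕ.^ toℕ j) - + (a ℕ.^ toℕ i) ≡ (+ a) ^ toℕ i * ((+ a) ^ d - 1ℤ)
      aʲ-aⁱ≡ = begin
        + (a ℕ.^ toℕ j) - + (a ℕ.^ toℕ i)      ≡⟨ cong₂ _-_ (pos-^ a (toℕ j)) (pos-^ a (toℕ i)) ⟩
        (+ a) ^ toℕ j - (+ a) ^ toℕ i          ≡⟨ cong (λ n → (+ a) ^ n - (+ a) ^ toℕ i) (sym (ℕ.m+[n∸m]≡n (ℕ.<⇒≤ i<j))) ⟩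
        (+ a) ^ (toℕ i ℕ.+ d) - (+ a) ^ toℕ i  ≡⟨ cong (_- (+ a) ^ toℕ i) (ℤ.^-distribˡ-+-* (+ a) (toℕ i) d) ⟩
        (+ a) ^ toℕ i * (+ a) ^ d - (+ a) ^ toℕ i ≡⟨ factor ((+ a) ^ toℕ i) ((+ a) ^ d) ⟩
        (+ a) ^ toℕ i * ((+ a) ^ d - 1ℤ) ∎
      p∣aᵈ-1 : + p ∣ (+ a) ^ d - 1ℤ
      p∣aᵈ-1 = Equivalence.to (coprime-∣^*⇔ p⊥a (toℕ i)) (subst (+ p ∣_) aʲ-aⁱ≡ (%-≡⇒∣- (same-residue i j same)))

  primitiveRoot⇒pow≡1 : ∀ {g q} → Prime q → IsPrimitiveRootModPrime g q → + q ∣ (+ g) ^ (q ∸ 1) - 1ℤ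
  primitiveRoot⇒pow≡1 {g} {q} q-prime (g⊥q , g-order-maximal) =
    from-period (pow≡1-mod-prime q-prime (ℕ.sym g⊥q))
    where
    from-period : (∃ λ d → 0 ℕ.< d × d ℕ.< q × + q ∣ (+ g) ^ d - 1ℤ) → + q ∣ (+ g) ^ (q ∸ 1) - 1ℤ
    from-period (d , 0<d , d<q , q∣gᵈ-1) with ℕ.m≤n⇒m<n∨m≡n (ℕ.∸-monoˡ-≤ 1 d<q)
    ... | inj₁ d<q-1 = ⊥-elim (g-order-maximal d 0<d d<q-1 (∣⇒∣ᵤ q∣gᵈ-1))
    ... | inj₂ d≡q-1 = subst (λ n → + q ∣ (+ g) ^ n - 1ℤ) d≡q-1 q∣gᵈ-1

  primitiveRoot⇒isOrderMod : ∀ {g q} → Prime q → IsPrimitiveRootModPrime g q → IsOrderMod q (+ g) (q ∸ 1)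
  primitiveRoot⇒isOrderMod {g} {q} q-prime root@(_ , g-order-maximal) =
    minimal⇒isOrderMod {{ℕ.>-nonZero 0<q-1}} (primitiveRoot⇒pow≡1 q-prime root)
      (λ r 0<r r<q-1 → g-order-maximal r 0<r r<q-1 ∘ ∣⇒∣ᵤ)
    where
    0<q-1 : 0 ℕ.< q ∸ 1
    0<q-1 = ℕ.∸-monoˡ-< (ℕ.nonTrivial⇒n>1 q {{prime⇒nonTrivial q-prime}}) ℕ.≤-refl

  -- Lifting the exponent

  infix 4 _^_∥_

  record _^_∥_ (p e : ℕ) (y : ℤ) : Set where
    constructor exactly
    field
      cofactor   : ℤ
      factorised : y ≡ + (p ℕ.^ e) * cofactor
      p∤cofactor : ¬ (+ p ∣ cofactor)

  pow-sub-one-expansion : ∀ {x} Q t k → x - 1ℤ ≡ Q * t →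
    x ^ k - 1ℤ ≡ Q * (+ k * t + Q * (t * t * binomialTail x k))
  pow-sub-one-expansion {x} Q t k x-1≡Qt = begin
    x ^ k - 1ℤ
      ≡⟨ cong (_- 1ℤ) (binomial-expansion x k) ⟩
    1ℤ + + k * (x - 1ℤ) + (x - 1ℤ) * (x - 1ℤ) * binomialTail x k - 1ℤ
      ≡⟨ cong (λ y → 1ℤ + + k * y + y * y * binomialTail x k - 1ℤ) x-1≡Qt ⟩
    1ℤ + + k * (Q * t) + Q * t * (Q * t) * binomialTail x k - 1ℤ
      ≡⟨ regroup (+ k) Q t (binomialTail x k) ⟩
    Q * (+ k * t + Q * (t * t * binomialTail x k)) ∎
    where
    regroup : ∀ k Q t c → 1ℤ + k * (Q * t) + Q * t * (Q * t) * c - 1ℤ ≡ Q * (k * t + Q * (t * t * c))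
    regroup = solve-∀

  ∥-lift : ∀ {p e x} → Prime p → 2 ℕ.< p → p ^ suc e ∥ x - 1ℤ → p ^ suc (suc e) ∥ x ^ p - 1ℤ
  ∥-lift {p} {e} {x} p-prime 2<p (exactly t x-1≡Qt p∤t)
    with divides c tail≡cp ← prime∣binomialTail p-prime 2<p
                               (subst (+ p ∣_) (sym x-1≡Qt) (∣m⇒∣m*n t (p∣p^suc p e))) =
    exactly (t + Q * t * t * c) xᵖ-1≡ p∤t′
    where
    Q = + (p ℕ.^ suc e)
    regroup : ∀ p Q t c → Q * (p * t + Q * (t * t * (c * p))) ≡ p * Q * (t + Q * t * t * c)
    regroup = solve-∀
    xᵖ-1≡ : x ^ p - 1ℤ ≡ + (p ℕ.^ suc (suc e)) * (t + Q * t * t * c)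
    xᵖ-1≡ = begin
      x ^ p - 1ℤ
        ≡⟨ pow-sub-one-expansion Q t p x-1≡Qt ⟩
      Q * (+ p * t + Q * (t * t * binomialTail x p))
        ≡⟨ cong (λ z → Q * (+ p * t + Q * (t * t * z))) tail≡cp ⟩
      Q * (+ p * t + Q * (t * t * (c * + p)))
        ≡⟨ regroup (+ p) Q t c ⟩
      + p * Q * (t + Q * t * t * c)
        ≡⟨ cong (_* (t + Q * t * t * c)) (sym (ℤ.pos-* p (p ℕ.^ suc e))) ⟩
      + (p ℕ.^ suc (suc e)) * (t + Q * t * t * c) ∎
    unshift : ∀ t Q c → t + Q * t * t * c - Q * t * t * c ≡ t
    unshift = solve-∀
    p∤t′ : ¬ (+ p ∣ t + Q * t * t * c)
    p∤t′ p∣t′ = p∤t (subst (+ p ∣_) (unshift t Q c)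
      (∣m∣n⇒∣m-n p∣t′ (∣m⇒∣m*n c (∣m⇒∣m*n t (∣m⇒∣m*n t (p∣p^suc p e))))))

  ∥⇒∣ : ∀ {p e y} → p ^ e ∥ y → + (p ℕ.^ e) ∣ y
  ∥⇒∣ {p} {e} (exactly t y≡Qt _) = divides t (trans y≡Qt (ℤ.*-comm (+ (p ℕ.^ e)) t))

  -- Writing a^N = 1 + p^(e+1) t, a^(kN) ≡ 1 + k p^(e+1) t (mod p^(e+2)), and p ∤ t forces p ∣ k.
  isOrderMod-lift : ∀ {p e a N} → Prime p → 2 ℕ.< p →
    IsOrderMod (p ℕ.^ suc e) a N → p ^ suc e ∥ a ^ N - 1ℤ →
    IsOrderMod (p ℕ.^ suc (suc e)) a (N ℕ.* p)
  isOrderMod-lift {p} {e} {a} {N} p-prime 2<p order exact@(exactly t aᴺ-1≡Qt p∤t) d = mk⇔ to from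
    where
    instance
      _ = prime⇒nonZero p-prime
    Q = + (p ℕ.^ suc e)
    pQ≡Qp : + (p ℕ.^ suc (suc e)) ≡ Q * + p
    pQ≡Qp = trans (ℤ.pos-* p (p ℕ.^ suc e)) (ℤ.*-comm (+ p) Q)
    from : N ℕ.* p ℕ.∣ d → + (p ℕ.^ suc (suc e)) ∣ a ^ d - 1ℤ
    from = ∣pow-sub-one⇒∣pow-multiple-sub-one
      (subst (λ y → _ ∣ y - 1ℤ) (ℤ.^-*-assoc a N p) (∥⇒∣ (∥-lift p-prime 2<p exact)))
    to : + (p ℕ.^ suc (suc e)) ∣ a ^ d - 1ℤ → N ℕ.* p ℕ.∣ d
    to pQ∣aᵈ-1 = lift (Equivalence.to (order d) (∣-trans (divides (+ p) (ℤ.pos-* p _)) pQ∣aᵈ-1))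
      where
      lift : N ℕ.∣ d → N ℕ.* p ℕ.∣ d
      lift (ℕ.divides k d≡kN) = subst (N ℕ.* p ℕ.∣_) (sym d≡kN) N*p∣k*N
        where
        aᵈ-1≡ : a ^ d - 1ℤ ≡ Q * (+ k * t + Q * (t * t * binomialTail (a ^ N) k))
        aᵈ-1≡ = begin
          a ^ d - 1ℤ         ≡⟨ cong (λ n → a ^ n - 1ℤ) (trans d≡kN (ℕ.*-comm k N)) ⟩
          a ^ (N ℕ.* k) - 1ℤ ≡⟨ cong (_- 1ℤ) (sym (ℤ.^-*-assoc a N k)) ⟩
          (a ^ N) ^ k - 1ℤ   ≡⟨ pow-sub-one-expansion Q t k aᴺ-1≡Qt ⟩
          Q * (+ k * t + Q * (t * t * binomialTail (a ^ N) k)) ∎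
        p∣kt : + p ∣ + k * t
        p∣kt = ∣m+n∣n⇒∣m
          (*-cancelˡ-∣ Q {{ℕ.m^n≢0 p (suc e)}} (subst₂ _∣_ pQ≡Qp aᵈ-1≡ pQ∣aᵈ-1))
          (∣m⇒∣m*n _ (p∣p^suc p e))
        p⊥t : ℕ.Coprime p ∣ t ∣
        p⊥t = prime∤⇒coprime p-prime (p∤t ∘ ∣ᵤ⇒∣)
        p∣k : p ℕ.∣ k
        p∣k = ∣⇒∣ᵤ (Equivalence.to (coprime-∣*⇔ t p⊥t) (subst (+ p ∣_) (ℤ.*-comm (+ k) t) p∣kt))
        N*p∣k*N : N ℕ.* p ℕ.∣ k ℕ.* N
        N*p∣k*N = subst (N ℕ.* p ℕ.∣_) (ℕ.*-comm N k) (ℕ.*-monoʳ-∣ N p∣k)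

  isOrderMod-prime-power : ∀ {p a N} → Prime p → 2 ℕ.< p →
    IsOrderMod (p ℕ.^ 1) a N → p ^ 1 ∥ a ^ N - 1ℤ →
    ∀ e → IsOrderMod (p ℕ.^ suc e) a (N ℕ.* p ℕ.^ e)
  isOrderMod-prime-power {p} {a} {N} p-prime 2<p order exact e = proj₁ (lifted e)
    where
    lifted : ∀ e → IsOrderMod (p ℕ.^ suc e) a (N ℕ.* p ℕ.^ e) × p ^ suc e ∥ a ^ (N ℕ.* p ℕ.^ e) - 1ℤ
    lifted zero = subst (λ M → IsOrderMod (p ℕ.^ 1) a M × p ^ 1 ∥ a ^ M - 1ℤ)
                        (sym (ℕ.*-identityʳ N)) (order , exact)
    lifted (suc e) with lifted e
    ... | orderₑ , exactₑ = subst (λ M → IsOrderMod (p ℕ.^ suc (suc e)) a M × p ^ suc (suc e) ∥ a ^ M - 1ℤ)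
      (trans (ℕ.*-assoc N (p ℕ.^ e) p) (cong (N ℕ.*_) (ℕ.*-comm (p ℕ.^ e) p)))
      ( isOrderMod-lift p-prime 2<p orderₑ exactₑ
      , subst (λ y → p ^ suc (suc e) ∥ y - 1ℤ) (ℤ.^-*-assoc a (N ℕ.* p ℕ.^ e) p) (∥-lift p-prime 2<p exactₑ))

  ∣∧∤⇒∥ : ∀ {p y} → + p ∣ y → ¬ (+ (p ℕ.^ 2) ∣ y) → p ^ 1 ∥ y
  ∣∧∤⇒∥ {p} {y} (divides t y≡tp) p²∤y = exactly t y≡pt p∤t
    where
    y≡pt : y ≡ + (p ℕ.^ 1) * t
    y≡pt = trans y≡tp (trans (ℤ.*-comm t (+ p)) (cong (λ n → + n * t) (sym (ℕ.*-identityʳ p))))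
    p∤t : ¬ (+ p ∣ t)
    p∤t (divides s t≡sp) = p²∤y (divides s (begin
      y                      ≡⟨ y≡tp ⟩
      t * + p                ≡⟨ cong (_* + p) t≡sp ⟩
      s * + p * + p          ≡⟨ ℤ.*-assoc s (+ p) (+ p) ⟩
      s * (+ p * + p)        ≡⟨ cong (s *_) (sym (ℤ.pos-* p p)) ⟩
      s * + (p ℕ.* p)        ≡⟨ cong (λ n → s * + (p ℕ.* n)) (sym (ℕ.*-identityʳ p)) ⟩
      s * + (p ℕ.^ 2)        ∎))

module IncongruenceOfU where

  open MultiplicativeOrder

  open import Data.Empty using (⊥-elim)
  open import Data.Integer.Base using (ℤ; +_; 1ℤ; -1ℤ; _+_; _-_; _*_; _^_; ∣_∣)
  open import Data.Integer.DivMod using (_/_; _%_; a≡a%n+[a/n]*n; n%d<d)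
  import Data.Integer.Divisibility as Unsigned using (_∣_)
  open import Data.Integer.Divisibility.Signed
  import Data.Integer.Properties as ℤ
  open import Data.Integer.Tactic.RingSolver using (solve-∀)
  open import Data.Nat.Base as ℕ using (ℕ; zero; suc; _∸_; s≤s; z≤n)
  import Data.Nat.Coprimality as ℕ
  import Data.Nat.Divisibility as ℕ
  import Data.Nat.DivMod as ℕ
  open import Data.Nat.Primality using (Prime; prime⇒irreducible; prime⇒nonZero)
  import Data.Nat.Properties as ℕ
  open import Data.Product using (∃; _,_)
  open import Data.Sum using (_⊎_; inj₁; inj₂; [_,_]′)
  open import Function.Base using (_∘_)
  open import Function.Bundles using (_⇔_; mk⇔; Equivalence)
  open import Function.Construct.Composition using (_⇔-∘_)
  open import Function.Construct.Symmetry using (⇔-sym)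
  open import Relation.Binary.PropositionalEquality
    using (_≡_; refl; sym; trans; cong; cong₂; subst; subst₂; module ≡-Reasoning)
  open import Relation.Nullary using (¬_)

  open ≡-Reasoning

  -1^-cases : ∀ n → -1ℤ ^ n ≡ 1ℤ ⊎ -1ℤ ^ n ≡ -1ℤ
  -1^-cases zero = inj₁ refl
  -1^-cases (suc n) with -1^-cases n
  ... | inj₁ even = inj₂ (cong (-1ℤ *_) even)
  ... | inj₂ odd  = inj₁ (cong (-1ℤ *_) odd)

  -1^-even : ∀ {n} → 2 ℕ.∣ n → -1ℤ ^ n ≡ 1ℤ
  -1^-even (ℕ.divides k refl) =
    trans (cong (-1ℤ ^_) (ℕ.*-comm k 2)) (trans (sym (ℤ.^-*-assoc -1ℤ 2 k)) (ℤ.^-zeroˡ k))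

  prime⇒odd : ∀ {p} → Prime p → 2 ℕ.< p → ∃ λ k → p ≡ suc (k ℕ.* 2)
  prime⇒odd {p} p-prime 2<p with p ℕ.% 2 in p%2≡ | ℕ.m%n<n p 2
  ... | 0 | _ = ⊥-elim ([ (λ ()) , (λ 2≡p → ℕ.<-irrefl 2≡p 2<p) ]′
                          (prime⇒irreducible p-prime (ℕ.m%n≡0⇒n∣m p 2 p%2≡)))
  ... | 1 | _ = p ℕ./ 2 , trans (ℕ.m≡m%n+[m/n]*n p 2) (cong (ℕ._+ p ℕ./ 2 ℕ.* 2) p%2≡)
  ... | suc (suc _) | s≤s (s≤s ())

  3^≡-1^-mod-4 : ∀ j → ∃ λ a → (+ 3) ^ j ≡ -1ℤ ^ j + + 4 * a
  3^≡-1^-mod-4 zero = + 0 , refl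
  3^≡-1^-mod-4 (suc j) with 3^≡-1^-mod-4 j
  ... | a , 3ʲ≡ = -1ℤ ^ j + + 3 * a , trans (cong (+ 3 *_) 3ʲ≡) (regroup (-1ℤ ^ j) a)
    where
    regroup : ∀ s a → + 3 * (s + + 4 * a) ≡ -1ℤ * s + + 4 * (s + + 3 * a)
    regroup = solve-∀

  -1^*odd≡1-mod-4 : ∀ k → ∃ λ b → -1ℤ ^ k * + suc (k ℕ.* 2) ≡ 1ℤ + + 4 * b
  -1^*odd≡1-mod-4 zero = + 0 , refl
  -1^*odd≡1-mod-4 (suc zero) = -1ℤ , refl
  -1^*odd≡1-mod-4 (suc (suc k)) with -1^*odd≡1-mod-4 k
  ... | b , eq = b + s , (begin
    -1ℤ * (-1ℤ * s) * (+ 4 + x) ≡⟨ expand s x ⟩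
    s * x + + 4 * s            ≡⟨ cong (_+ + 4 * s) eq ⟩
    1ℤ + + 4 * b + + 4 * s     ≡⟨ collect b s ⟩
    1ℤ + + 4 * (b + s)         ∎)
    where
    s = -1ℤ ^ k
    x = + suc (k ℕ.* 2)
    expand : ∀ s x → -1ℤ * (-1ℤ * s) * (+ 4 + x) ≡ s * x + + 4 * s
    expand = solve-∀
    collect : ∀ b s → 1ℤ + + 4 * b + + 4 * s ≡ 1ℤ + + 4 * (b + s)
    collect = solve-∀

  qStar≡1-mod-4 : ∀ k → ∃ λ b → qStar (suc (k ℕ.* 2)) ≡ 1ℤ + + 4 * b
  qStar≡1-mod-4 k with -1^*odd≡1-mod-4 k
  ... | b , eq = b , trans (cong (λ n → -1ℤ ^ n * + suc (k ℕ.* 2)) (ℕ.m*n/n≡m k 2)) eq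

  n*i/n≡i : ∀ n i .{{_ : ℕ.NonZero n}} → (+ n * i) / + n ≡ i
  n*i/n≡i n i = sym (ℤ.i-j≡0⇒i≡j i q (ℤ.∣i∣≡0⇒i≡0 ∣i-q∣≡0))
    where
    q = (+ n * i) / + n
    r = (+ n * i) % + n
    cancel : ∀ r s → r ≡ r + s - s
    cancel = solve-∀
    factor : ∀ i q n → n * i - q * n ≡ (i - q) * n
    factor = solve-∀
    r≡ : + r ≡ (i - q) * + n
    r≡ = begin
      + r                     ≡⟨ cancel (+ r) (q * + n) ⟩
      + r + q * + n - q * + n ≡⟨ cong (_- q * + n) (sym (a≡a%n+[a/n]*n (+ n * i) (+ n))) ⟩
      + n * i - q * + n       ≡⟨ factor i q (+ n) ⟩
      (i - q) * + n           ∎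
    ∣i-q∣*n<1*n : ∣ i - q ∣ ℕ.* n ℕ.< 1 ℕ.* n
    ∣i-q∣*n<1*n = subst₂ ℕ._<_ (trans (cong ∣_∣ r≡) (ℤ.abs-* (i - q) (+ n))) (sym (ℕ.*-identityˡ n))
                         (n%d<d (+ n * i) (+ n))
    ∣i-q∣≡0 : ∣ i - q ∣ ≡ 0
    ∣i-q∣≡0 = ℕ.n<1⇒n≡0 (ℕ.*-cancelʳ-< n ∣ i - q ∣ 1 ∣i-q∣*n<1*n)

  -- The division by 4 in the definition of u is exact since 3 ≡ -1 and q* ≡ 1 (mod 4).
  four-u : ∀ {q} k → q ≡ suc (k ℕ.* 2) → ∀ j → + 4 * u q j ≡ (+ 3) ^ j - qStar q * -1ℤ ^ j
  four-u k refl j with 3^≡-1^-mod-4 j | qStar≡1-mod-4 k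
  ... | a , 3ʲ≡ | b , q*≡ = begin
    + 4 * (numerator / + 4)  ≡⟨ cong (λ z → + 4 * (z / + 4)) numerator≡ ⟩
    + 4 * ((+ 4 * w) / + 4)  ≡⟨ cong (+ 4 *_) (n*i/n≡i 4 w) ⟩
    + 4 * w                  ≡⟨ sym numerator≡ ⟩
    numerator                ∎
    where
    s = -1ℤ ^ j
    numerator = (+ 3) ^ j - qStar (suc (k ℕ.* 2)) * s
    w = a - b * s
    regroup : ∀ s a b → s + + 4 * a - (1ℤ + + 4 * b) * s ≡ + 4 * (a - b * s)
    regroup = solve-∀
    numerator≡ : numerator ≡ + 4 * w
    numerator≡ = trans (cong₂ (λ x y → x - y * s) 3ʲ≡ q*≡) (regroup s a b)

  four-u-difference : ∀ {q} k → q ≡ suc (k ℕ.* 2) → ∀ i D →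
    + 4 * (u q (i ℕ.+ D) - u q i)
      ≡ (+ 3) ^ i * ((+ 3) ^ D - 1ℤ) - qStar q * -1ℤ ^ i * (-1ℤ ^ D - 1ℤ)
  four-u-difference {q} k q≡ i D = begin
    + 4 * (u q (i ℕ.+ D) - u q i)
      ≡⟨ distrib (u q (i ℕ.+ D)) (u q i) ⟩
    + 4 * u q (i ℕ.+ D) - + 4 * u q i
      ≡⟨ cong₂ _-_ (four-u k q≡ (i ℕ.+ D)) (four-u k q≡ i) ⟩
    (+ 3) ^ (i ℕ.+ D) - qStar q * -1ℤ ^ (i ℕ.+ D) - ((+ 3) ^ i - qStar q * -1ℤ ^ i)
      ≡⟨ cong₂ (λ x y → x - qStar q * y - ((+ 3) ^ i - qStar q * -1ℤ ^ i))
               (ℤ.^-distribˡ-+-* (+ 3) i D) (ℤ.^-distribˡ-+-* -1ℤ i D) ⟩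
    (+ 3) ^ i * (+ 3) ^ D - qStar q * (-1ℤ ^ i * -1ℤ ^ D) - ((+ 3) ^ i - qStar q * -1ℤ ^ i)
      ≡⟨ regroup ((+ 3) ^ i) ((+ 3) ^ D) (qStar q) (-1ℤ ^ i) (-1ℤ ^ D) ⟩
    (+ 3) ^ i * ((+ 3) ^ D - 1ℤ) - qStar q * -1ℤ ^ i * (-1ℤ ^ D - 1ℤ) ∎
    where
    distrib : ∀ x y → + 4 * (x - y) ≡ + 4 * x - + 4 * y
    distrib = solve-∀
    regroup : ∀ a A c s S → a * A - c * (s * S) - (a - c * s) ≡ a * (A - 1ℤ) - c * s * (S - 1ℤ)
    regroup = solve-∀

  module _ {q m N : ℕ} (k : ℕ) (q≡2k+1 : q ≡ suc (k ℕ.* 2)) (order-q : IsOrderMod q (+ 3) (q ∸ 1))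
           (q∣m : q ℕ.∣ m) (m⊥2 : ℕ.Coprime m 2) (m⊥3 : ℕ.Coprime m 3) (order-m : IsOrderMod m (+ 3) N)
           where

    q∣3ᴰ-1⇒2∣D : ∀ {D} → + q ∣ (+ 3) ^ D - 1ℤ → 2 ℕ.∣ D
    q∣3ᴰ-1⇒2∣D q∣3ᴰ-1 = ℕ.∣-trans (ℕ.divides k (cong (_∸ 1) q≡2k+1)) (Equivalence.to (order-q _) q∣3ᴰ-1)

    2∣N : 2 ℕ.∣ N
    2∣N = q∣3ᴰ-1⇒2∣D (∣-trans (∣ᵤ⇒∣ q∣m) (Equivalence.from (order-m N) ℕ.∣-refl))

    congruent⇔order∣ : ∀ i D → (+ m ∣ u q (i ℕ.+ D) - u q i) ⇔ N ℕ.∣ D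
    congruent⇔order∣ i D with -1^-cases D
    ... | inj₁ -1ᴰ≡1 = order-m D ⇔-∘ (coprime-∣^*⇔ m⊥3 i ⇔-∘ (m∣4Δu⇔ ⇔-∘ ⇔-sym m∣4*⇔))
      where
      m∣4*⇔ : (+ m ∣ + 4 * (u q (i ℕ.+ D) - u q i)) ⇔ (+ m ∣ u q (i ℕ.+ D) - u q i)
      m∣4*⇔ = coprime-∣*⇔ (+ 4) (coprime-^ʳ m⊥2 2)
      vanish : ∀ a c → a - c * (1ℤ - 1ℤ) ≡ a
      vanish = solve-∀
      4Δu≡ : + 4 * (u q (i ℕ.+ D) - u q i) ≡ (+ 3) ^ i * ((+ 3) ^ D - 1ℤ)
      4Δu≡ = begin
        + 4 * (u q (i ℕ.+ D) - u q i)
          ≡⟨ four-u-difference k q≡2k+1 i D ⟩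
        (+ 3) ^ i * ((+ 3) ^ D - 1ℤ) - qStar q * -1ℤ ^ i * (-1ℤ ^ D - 1ℤ)
          ≡⟨ cong (λ s → (+ 3) ^ i * ((+ 3) ^ D - 1ℤ) - qStar q * -1ℤ ^ i * (s - 1ℤ)) -1ᴰ≡1 ⟩
        (+ 3) ^ i * ((+ 3) ^ D - 1ℤ) - qStar q * -1ℤ ^ i * (1ℤ - 1ℤ)
          ≡⟨ vanish ((+ 3) ^ i * ((+ 3) ^ D - 1ℤ)) (qStar q * -1ℤ ^ i) ⟩
        (+ 3) ^ i * ((+ 3) ^ D - 1ℤ) ∎
      m∣4Δu⇔ : (+ m ∣ + 4 * (u q (i ℕ.+ D) - u q i)) ⇔ (+ m ∣ (+ 3) ^ i * ((+ 3) ^ D - 1ℤ))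
      m∣4Δu⇔ = mk⇔ (subst (+ m ∣_) 4Δu≡) (subst (+ m ∣_) (sym 4Δu≡))
    ... | inj₂ -1ᴰ≡-1 = mk⇔ (⊥-elim ∘ D-odd ∘ q∣3ᴰ-1⇒2∣D ∘ q∣3ᴰ-1) (⊥-elim ∘ D-odd ∘ ℕ.∣-trans 2∣N)
      where
      D-odd : ¬ 2 ℕ.∣ D
      D-odd 2∣D with trans (sym -1ᴰ≡-1) (-1^-even 2∣D)
      ... | ()
      add-back : ∀ x y → x - y + y ≡ x
      add-back = solve-∀
      q∣3ᴰ-1 : + m ∣ u q (i ℕ.+ D) - u q i → + q ∣ (+ 3) ^ D - 1ℤ
      q∣3ᴰ-1 m∣Δu = Equivalence.to (coprime-∣^*⇔ (coprime-∣ˡ q∣m m⊥3) i)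
        (subst (+ q ∣_) (add-back _ _) (∣m∣n⇒∣m+n q∣4Δu (∣m⇒∣m*n _ (∣m⇒∣m*n _ q∣qStar))))
        where
        q∣qStar : + q ∣ qStar q
        q∣qStar = divides (-1ℤ ^ ((q ∸ 1) ℕ./ 2)) refl
        q∣4Δu : + q ∣ (+ 3) ^ i * ((+ 3) ^ D - 1ℤ) - qStar q * -1ℤ ^ i * (-1ℤ - 1ℤ)
        q∣4Δu = subst (+ q ∣_)
          (trans (four-u-difference k q≡2k+1 i D)
                 (cong (λ s → (+ 3) ^ i * ((+ 3) ^ D - 1ℤ) - qStar q * -1ℤ ^ i * (s - 1ℤ)) -1ᴰ≡-1))
          (∣-trans (∣ᵤ⇒∣ q∣m) (∣n⇒∣m*n (+ 4) m∣Δu))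

    congruent-pair⇔ : ∀ {i j} → i ℕ.< j → (+ m Unsigned.∣ u q i - u q j) ⇔ N ℕ.∣ j ∸ i
    congruent-pair⇔ {i} {j} i<j = congruent⇔order∣ i (j ∸ i) ⇔-∘ unsigned⇔signed
      where
      unsigned⇔signed : (+ m Unsigned.∣ u q i - u q j) ⇔ (+ m ∣ u q (i ℕ.+ (j ∸ i)) - u q i)
      unsigned⇔signed rewrite ℕ.m+[n∸m]≡n (ℕ.<⇒≤ i<j) = mk⇔
        (∣ᵤ⇒∣ ∘ subst (m ℕ.∣_) (ℤ.∣i-j∣≡∣j-i∣ (u q i) (u q j)))
        (subst (m ℕ.∣_) (ℤ.∣i-j∣≡∣j-i∣ (u q j) (u q i)) ∘ ∣⇒∣ᵤ)

    pairwiseIncongruent⇔≤order : .{{_ : ℕ.NonZero N}} → ∀ n → PairwiseIncongruent q n m ⇔ n ℕ.≤ N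
    pairwiseIncongruent⇔≤order n = mk⇔ to from
      where
      1<1+N : 1 ℕ.< suc N
      1<1+N = s≤s (ℕ.>-nonZero⁻¹ N)
      to : PairwiseIncongruent q n m → n ℕ.≤ N
      to incongruent = ℕ.≮⇒≥ λ N<n → incongruent 1 (suc N) ℕ.≤-refl (ℕ.≤-trans (s≤s z≤n) N<n)
        (s≤s z≤n) N<n 1<1+N (Equivalence.from (congruent-pair⇔ 1<1+N) ℕ.∣-refl)
      from : n ℕ.≤ N → PairwiseIncongruent q n m
      from n≤N i j 1≤i _ _ j≤n i<j congruent =
        ℕ.<⇒≱ j∸i<N (ℕ.∣⇒≤ {{ℕ.>-nonZero (ℕ.m<n⇒0<n∸m i<j)}} (Equivalence.to (congruent-pair⇔ i<j) congruent))
        where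
        j∸i<N : j ∸ i ℕ.< N
        j∸i<N = ℕ.<-≤-trans (ℕ.∸-monoʳ-< 1≤i (ℕ.<⇒≤ i<j)) (ℕ.≤-trans j≤n n≤N)

  module _ {q} (q-prime : Prime q) (5≤q : 5 ℕ.≤ q) (root : IsPrimitiveRootModPrime 3 q) where

    private
      2<q : 2 ℕ.< q
      2<q = ℕ.<-≤-trans (s≤s (s≤s (s≤s z≤n))) 5≤q
      q⊥2 : ℕ.Coprime q 2
      q⊥2 = ℕ.prime⇒coprime q-prime 2<q
      q⊥3 : ℕ.Coprime q 3
      q⊥3 = ℕ.prime⇒coprime q-prime (ℕ.<-≤-trans (s≤s (s≤s (s≤s (s≤s z≤n)))) 5≤q)
      order-q : IsOrderMod q (+ 3) (q ∸ 1)
      order-q = primitiveRoot⇒isOrderMod q-prime root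
      instance
        q≢0 : ℕ.NonZero q
        q≢0 = prime⇒nonZero q-prime
        q-1≢0 : ℕ.NonZero (q ∸ 1)
        q-1≢0 = ℕ.>-nonZero (ℕ.∸-monoˡ-< (ℕ.<-trans (ℕ.n<1+n 1) 2<q) ℕ.≤-refl)

    pairwiseIncongruent-mod-q⇔ : ∀ n → PairwiseIncongruent q n q ⇔ n ℕ.+ 1 ℕ.≤ q
    pairwiseIncongruent-mod-q⇔ n with k , q≡2k+1 ← prime⇒odd q-prime 2<q =
      ≤∸1⇔+1≤ ⇔-∘ pairwiseIncongruent⇔≤order k q≡2k+1 order-q ℕ.∣-refl q⊥2 q⊥3 order-q n
      where
      ≤∸1⇔+1≤ : ∀ {m n} .{{_ : ℕ.NonZero n}} → m ℕ.≤ n ∸ 1 ⇔ m ℕ.+ 1 ℕ.≤ n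
      ≤∸1⇔+1≤ {m} {suc n} = mk⇔
        (λ m≤n → subst (ℕ._≤ suc n) (ℕ.+-comm 1 m) (s≤s m≤n))
        (λ m+1≤1+n → ℕ.s≤s⁻¹ (subst (ℕ._≤ suc n) (ℕ.+-comm m 1) m+1≤1+n))

    pairwiseIncongruent-mod-qᶠ⇔ : ∀ n → ¬ (+ (q ℕ.^ 2) Unsigned.∣ + (3 ℕ.^ (q ∸ 1)) - 1ℤ) → ∀ f → 1 ℕ.≤ f →
      PairwiseIncongruent q n (q ℕ.^ f) ⇔ q ℕ.* n ℕ.≤ q ℕ.^ f ℕ.* (q ∸ 1)
    pairwiseIncongruent-mod-qᶠ⇔ n q²∤3ᑫ⁻¹-1 (suc e) _ with k , q≡2k+1 ← prime⇒odd q-prime 2<q =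
      ≤⇔q*≤ ⇔-∘ pairwiseIncongruent⇔≤order k q≡2k+1 order-q (ℕ.divides (q ℕ.^ e) (ℕ.*-comm q _))
                  (coprime-^ˡ q⊥2 (suc e)) (coprime-^ˡ q⊥3 (suc e)) order-qᵉ⁺¹ n
      where
      instance
        _ = ℕ.m^n≢0 q e
        _ = ℕ.m*n≢0 (q ∸ 1) (q ℕ.^ e)
      q²∤ : ¬ (+ (q ℕ.^ 2) ∣ (+ 3) ^ (q ∸ 1) - 1ℤ)
      q²∤ = q²∤3ᑫ⁻¹-1 ∘ ∣⇒∣ᵤ ∘ subst (λ z → + (q ℕ.^ 2) ∣ z - 1ℤ) (sym (pos-^ 3 (q ∸ 1)))
      order-qᵉ⁺¹ : IsOrderMod (q ℕ.^ suc e) (+ 3) ((q ∸ 1) ℕ.* q ℕ.^ e)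
      order-qᵉ⁺¹ = isOrderMod-prime-power q-prime 2<q
        (subst (λ m → IsOrderMod m (+ 3) (q ∸ 1)) (sym (ℕ.*-identityʳ q)) order-q)
        (∣∧∤⇒∥ (primitiveRoot⇒pow≡1 q-prime root) q²∤) e
      ≤⇔q*≤ : n ℕ.≤ (q ∸ 1) ℕ.* q ℕ.^ e ⇔ q ℕ.* n ℕ.≤ q ℕ.^ suc e ℕ.* (q ∸ 1)
      ≤⇔q*≤ = subst (λ x → n ℕ.≤ (q ∸ 1) ℕ.* q ℕ.^ e ⇔ q ℕ.* n ℕ.≤ x)
        (trans (cong (q ℕ.*_) (ℕ.*-comm (q ∸ 1) (q ℕ.^ e))) (sym (ℕ.*-assoc q (q ℕ.^ e) (q ∸ 1))))
        (mk⇔ (ℕ.*-monoʳ-≤ q) (ℕ.*-cancelˡ-≤ q))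

open import Data.Nat using (ℕ; _≤_; _+_; _*_; _^_; _∸_)
open import Data.Nat.Primality using (Prime)
open import Data.Integer using (+_; _-_)
open import Data.Integer.Divisibility using (_∣_)
open import Data.Product using (_×_; _,_)
open import Function.Bundles using (_⇔_)
open import Relation.Nullary using (¬_)

open IncongruenceOfU using (pairwiseIncongruent-mod-q⇔; pairwiseIncongruent-mod-qᶠ⇔)

lemma15 : (q : ℕ) → Prime q → 5 ≤ q → (n : ℕ) → 1 ≤ n →
    (IsPrimitiveRootModPrime 3 q →
      (PairwiseIncongruent q n q ⇔ n + 1 ≤ q))
    ×
    (IsPrimitiveRootModPrime 3 q →
      ¬ ((+ (q ^ 2)) ∣ ((+ (3 ^ (q ∸ 1))) - + 1)) →
      (f : ℕ) → 1 ≤ f →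
        (PairwiseIncongruent q n (q ^ f) ⇔ q * n ≤ q ^ f * (q ∸ 1)))
lemma15 q q-prime 5≤q n _ =
  (λ root → pairwiseIncongruent-mod-q⇔ q-prime 5≤q root n) ,
  (λ root → pairwiseIncongruent-mod-qᶠ⇔ q-prime 5≤q root n)
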